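{- Let $H$ be a connected graph (loops allowed) that is not a bi-arc graph and is not a strong split graph. Then $H^*$ admits a bipartite decomposition if and only if $H$ admits a $B$-decomposition, a $BP$-decomposition, or an $F$-decomposition.
   Context: Graphs may have loops. The associated bipartite graph $H^*$ has vertex set $\{v':v\in V(H)\}\cup\{v'':v\in V(H)\}$ (bipartition classes $X=\{v'\}$, $Y=\{v''\}$) with $u'v''\in E(H^*)$ iff $uv\in E(H)$ (including $u=v$ for loops). $H$ is a bi-arc graph iff $H^*$ is the complement of a circular-arc graph. A bipartite decomposition of a bipartite graph with classes $X,Y$ is a partition $(D,N,R)$ of its vertex set with $N\ne\emptyset$, no edges between $D$ and $R$, $|D\cap X|\ge 2$ or $|D\cap Y|\ge2$, $N\cap X$ complete to $N\cap Y$, $D\cap X$ complete to $N\cap Y$, and $D\cap Y$ complete to $N\cap X$. "$A$ complete to $B$": every $a\in A$, $b\in B$ are adjacent (for $A=B$ or overlapping sets this includes loops); "$A$ non-adjacent to $B$": no edge between $A$ and $B$; a reflexive clique is a set of pairwise adjacent vertices each with a loop. Sets may be empty unless stated. A strong split graph is one whose vertex set partitions into an independent set (no loops) and a reflexive clique. An $F$-decomposition of $H$ is a partition $(F,K,Z)$ of $V(H)$ with: $K\ne\emptyset$ and no edges between $F$ and $Z$; $|F|\ge2$; $K$ a reflexive clique; $F$ complete to $K$. A $BP$-decomposition is a partition $(B,P,M,K,Z)$ with: $K\cup M\ne\emptyset$ and no edges between $P\cup B$ and $Z$; $|P|\ge2$ or $|B|\ge2$; $K\cup P$ a reflexive clique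 and $B$ independent; $M$ complete to $P\cup K$ and $B$ complete to $K$; $B$ non-adjacent to $M$. A $B$-decomposition is a partition $(B_1,B_2,K,M_1,M_2,Z)$ with: $K\cup M_1\cup M_2\ne\emptyset$ and no edges between $B_1\cup B_2$ and $Z$; $|B_1|\ge2$ or $|B_2|\ge 2$; $K$ a reflexive clique and $B_1,B_2$ independent; $K$ complete to $M_1\cup M_2\cup B_1\cup B_2$, $M_2$ complete to $M_1\cup B_1$, $M_1$ complete to $B_2$; $B_1$ non-adjacent to $M_1$ and $B_2$ non-adjacent to $M_2$. -}

module Defs where

open import Data.Nat using (ℕ; zero; suc; _+_; _∸_; _≤_; _%_)
open import Data.Fin using (Fin; toℕ)
open import Data.Bool using (Bool; true; false)
open import Data.Sum using (_⊎_; inj₁; inj₂)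
open import Data.Product using (Σ; ∃; _×_; _,_)
open import Data.Unit using (⊤)
open import Data.Empty using (⊥)
open import Relation.Nullary using (¬_)
open import Relation.Binary.PropositionalEquality using (_≡_; _≢_)
open import Function.Bundles using (_⇔_)

module _ {V : Set} (E : V → V → Set) where

  -- A complete to B (a = b allowed, so this includes loops)
  Complete : (V → Set) → (V → Set) → Set
  Complete A B = ∀ a b → A a → B b → E a b

  NonAdj : (V → Set) → (V → Set) → Set
  NonAdj A B = ∀ a b → A a → B b → ¬ E a b

  ReflClique : (V → Set) → Set
  ReflClique A = Complete A A

  Independent : (V → Set) → Set
  Independent A = NonAdj A A

  data Reach : V → V → Set where
    here : ∀ {u} → Reach u u
    step : ∀ {u w v} → E u w → Reach w v → Reach u v

  Connected : Set
  Connected = ∀ u v → Reach u v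

Nonempty : {V : Set} → (V → Set) → Set
Nonempty {V} A = Σ V A

AtLeastTwo : {V : Set} → (V → Set) → Set
AtLeastTwo {V} A = Σ V λ a → Σ V λ b → a ≢ b × A a × A b

_∪_ : {V : Set} → (V → Set) → (V → Set) → (V → Set)
(A ∪ B) v = A v ⊎ B v

_∩_ : {V : Set} → (V → Set) → (V → Set) → (V → Set)
(A ∩ B) v = A v × B v

Part : {V L : Set} → (V → L) → L → (V → Set)
Part lab ℓ v = lab v ≡ ℓ

-- Finite graphs with loops: vertex set Fin n, symmetric Boolean adjacency
-- (adj v v = true means a loop at v).

record Graph (n : ℕ) : Set where
  field
    adj : Fin n → Fin n → Bool
    adj-sym : ∀ u v → adj u v ≡ adj v u

  E : Fin n → Fin n → Set
  E u v = adj u v ≡ true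

open Graph public

-- Circular-arc graphs (simple graphs, adjacency only matters for distinct
-- vertices).  The circle is discretised to the cyclic set Z_(suc k); an
-- arc (s , e) is the closed clockwise arc s, s+1, ..., e (mod suc k).
-- For finite graphs this is equivalent to arcs on the real circle
-- (only the cyclic order of the endpoints matters).

InArc : (k : ℕ) → Fin (suc k) → Fin (suc k) → Fin (suc k) → Set
InArc k s e p =
  ((toℕ p + suc k ∸ toℕ s) % suc k) ≤ ((toℕ e + suc k ∸ toℕ s) % suc k)

ArcsMeet : (k : ℕ) → (Fin (suc k) × Fin (suc k)) → (Fin (suc k) × Fin (suc k)) → Set
ArcsMeet k (s₁ , e₁) (s₂ , e₂) = Σ (Fin (suc k)) λ p → InArc k s₁ e₁ p × InArc k s₂ e₂ p

CircularArc : {V : Set} → (V → V → Set) → Set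
CircularArc {V} R =
  Σ ℕ λ k → Σ (V → Fin (suc k) × Fin (suc k)) λ arc →
    ∀ x y → x ≢ y → (R x y ⇔ ArcsMeet k (arc x) (arc y))

-- The associated bipartite graph H*: vertices Fin n ⊎ Fin n,
-- X = inj₁ (the v'), Y = inj₂ (the v'').

Star : ∀ {n} → Graph n → (Fin n ⊎ Fin n) → (Fin n ⊎ Fin n) → Set
Star H (inj₁ u) (inj₂ v) = E H u v
Star H (inj₂ v) (inj₁ u) = E H u v
Star H (inj₁ _) (inj₁ _) = ⊥
Star H (inj₂ _) (inj₂ _) = ⊥

IsX : ∀ {n} → (Fin n ⊎ Fin n) → Set
IsX (inj₁ _) = ⊤
IsX (inj₂ _) = ⊥

IsY : ∀ {n} → (Fin n ⊎ Fin n) → Set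
IsY (inj₁ _) = ⊥
IsY (inj₂ _) = ⊤

-- H is bi-arc iff the complement of H* is a circular-arc graph
BiArc : ∀ {n} → Graph n → Set
BiArc H = CircularArc (λ x y → ¬ Star H x y)

StrongSplit : ∀ {n} → Graph n → Set
StrongSplit {n} H = Σ (Fin n → Bool) λ f →
  Independent (E H) (Part f false) × ReflClique (E H) (Part f true)

data DNR : Set where D N R : DNR

BipDecomp : ∀ {n} → Graph n → Set
BipDecomp {n} H = Σ (Fin n ⊎ Fin n → DNR) λ lab →
  let Ds = Part lab D ; Ns = Part lab N ; Rs = Part lab R ; S = Star H in
  Nonempty Ns ×
  NonAdj S Ds Rs ×
  (AtLeastTwo (Ds ∩ IsX) ⊎ AtLeastTwo (Ds ∩ IsY)) ×
  Complete S (Ns ∩ IsX) (Ns ∩ IsY) ×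
  Complete S (Ds ∩ IsX) (Ns ∩ IsY) ×
  Complete S (Ds ∩ IsY) (Ns ∩ IsX)

data FKZ : Set where F K Z : FKZ

FDecomp : ∀ {n} → Graph n → Set
FDecomp {n} H = Σ (Fin n → FKZ) λ lab →
  let Fs = Part lab F ; Ks = Part lab K ; Zs = Part lab Z ; G = E H in
  Nonempty Ks ×
  NonAdj G Fs Zs ×
  AtLeastTwo Fs ×
  ReflClique G Ks ×
  Complete G Fs Ks

data BPMKZ : Set where B P M K Z : BPMKZ

BPDecomp : ∀ {n} → Graph n → Set
BPDecomp {n} H = Σ (Fin n → BPMKZ) λ lab →
  let Bs = Part lab B ; Ps = Part lab P ; Ms = Part lab M
      Ks = Part lab K ; Zs = Part lab Z ; G = E H in
  Nonempty (Ks ∪ Ms) ×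
  NonAdj G (Ps ∪ Bs) Zs ×
  (AtLeastTwo Ps ⊎ AtLeastTwo Bs) ×
  ReflClique G (Ks ∪ Ps) ×
  Independent G Bs ×
  Complete G Ms (Ps ∪ Ks) ×
  Complete G Bs Ks ×
  NonAdj G Bs Ms

data BBKMMZ : Set where B₁ B₂ K M₁ M₂ Z : BBKMMZ

BDecomp : ∀ {n} → Graph n → Set
BDecomp {n} H = Σ (Fin n → BBKMMZ) λ lab →
  let B1 = Part lab B₁ ; B2 = Part lab B₂ ; Ks = Part lab K
      M1 = Part lab M₁ ; M2 = Part lab M₂ ; Zs = Part lab Z ; G = E H in
  Nonempty ((Ks ∪ M1) ∪ M2) ×
  NonAdj G (B1 ∪ B2) Zs ×
  (AtLeastTwo B1 ⊎ AtLeastTwo B2) ×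
  ReflClique G Ks ×
  Independent G B1 ×
  Independent G B2 ×
  Complete G Ks (((M1 ∪ M2) ∪ B1) ∪ B2) ×
  Complete G M2 (M1 ∪ B1) ×
  Complete G M1 B2 ×
  NonAdj G B1 M1 ×
  NonAdj G B2 M2

-- Give every vertex v of H the type (x, y) ∈ {D, N, R}² formed by the classes of v′
-- and v″ in a bipartite decomposition of H*.  The edge uw of H is both u′w″ and w′u″
-- in H*, so the decomposition forces it when one of these pairs of classes is N–N, D–N
-- or N–D and forbids it when one is D–R or R–D: all it says about H depends only on
-- which of the nine types occur.  No two occurring types can be both forced and
-- forbidden, and in a connected H no type can be forbidden next to all the others.
-- For each of the remaining sets of types one of four fixed labellings of the types
-- is a B-, BP- or F-decomposition; this is checked by evaluating a decision procedure
-- on all 2⁹ sets.  An F-labelling may only know that Z is independent instead of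
-- |F| ≥ 2; then a single F-vertex joins the clique or the independent set according
-- to its loop, and H is strong split.  Conversely, each of the three decompositions
-- becomes a bipartite decomposition of H* by giving every part a class on each side.
module Submission where

open import Defs
open import Data.Bool using (Bool; true; false; T; _∨_)
open import Data.Bool.Properties using (T-∨)
open import Data.Empty using (⊥-elim)
open import Data.Fin using (Fin)
open import Data.Fin.Properties using (any?) renaming (_≟_ to _≟ᶠ_)
open import Data.Nat using (ℕ)
open import Data.Nat.Properties using (eq?)
open import Data.Product using (Σ; ∃; _×_; _,_; proj₁; proj₂)
open import Data.Product.Properties using (≡-dec)
open import Data.Sum using (_⊎_; inj₁; inj₂; [_,_]; [_,_]′) renaming (map to ⊎-map; swap to ⊎-swap)
open import Data.Sum.Properties using (inj₁-injective; inj₂-injective)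
open import Data.Unit using (tt)
open import Function using (_∘_; id)
open import Function.Bundles using (_⇔_; mk⇔; mk↣; Equivalence)
open import Relation.Binary.Definitions using (DecidableEquality)
open import Relation.Binary.PropositionalEquality using (_≡_; refl; sym; trans; cong; subst; _≢_)
open import Relation.Nullary
  using (¬_; Dec; yes; no; isYes; map′; _×-dec_; _⊎-dec_; _→-dec_; ¬?; T?;
         toWitness; fromWitness; decidable-stable; contradiction)
open import Relation.Unary using (_⊆_) renaming (Decidable to Decidable₁)
open import Relation.Unary.Properties using (_∪?_; _∩?_)

≡-dec-via-code : {A : Set} (code : A → ℕ) (decode : ℕ → A) →
                 (∀ a → decode (code a) ≡ a) → DecidableEquality A
≡-dec-via-code code decode decode-code = eq? (mk↣ injective)
  where
  injective : ∀ {a b} → code a ≡ code b → a ≡ b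
  injective {a} {b} e = trans (sym (decode-code a)) (trans (cong decode e) (decode-code b))

module DNR-code where
  code : DNR → ℕ
  code D = 0
  code N = 1
  code R = 2

  decode : ℕ → DNR
  decode 0 = D
  decode 1 = N
  decode _ = R

  decode-code : ∀ x → decode (code x) ≡ x
  decode-code D = refl
  decode-code N = refl
  decode-code R = refl

_≟ᴰ_ : DecidableEquality DNR
_≟ᴰ_ = ≡-dec-via-code code decode decode-code where open DNR-code

module FKZ-code where
  code : FKZ → ℕ
  code F = 0
  code K = 1
  code Z = 2

  decode : ℕ → FKZ
  decode 0 = F
  decode 1 = K
  decode _ = Z

  decode-code : ∀ x → decode (code x) ≡ x
  decode-code F = refl
  decode-code K = refl
  decode-code Z = refl

_≟ᶠᵏᶻ_ : DecidableEquality FKZ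
_≟ᶠᵏᶻ_ = ≡-dec-via-code code decode decode-code where open FKZ-code

module BPMKZ-code where
  code : BPMKZ → ℕ
  code B = 0
  code P = 1
  code M = 2
  code K = 3
  code Z = 4

  decode : ℕ → BPMKZ
  decode 0 = B
  decode 1 = P
  decode 2 = M
  decode 3 = K
  decode _ = Z

  decode-code : ∀ x → decode (code x) ≡ x
  decode-code B = refl
  decode-code P = refl
  decode-code M = refl
  decode-code K = refl
  decode-code Z = refl

_≟ᵇᵖ_ : DecidableEquality BPMKZ
_≟ᵇᵖ_ = ≡-dec-via-code code decode decode-code where open BPMKZ-code

module BBKMMZ-code where
  code : BBKMMZ → ℕ
  code B₁ = 0
  code B₂ = 1
  code K = 2
  code M₁ = 3
  code M₂ = 4
  code Z = 5

  decode : ℕ → BBKMMZ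
  decode 0 = B₁
  decode 1 = B₂
  decode 2 = K
  decode 3 = M₁
  decode 4 = M₂
  decode _ = Z

  decode-code : ∀ x → decode (code x) ≡ x
  decode-code B₁ = refl
  decode-code B₂ = refl
  decode-code K = refl
  decode-code M₁ = refl
  decode-code M₂ = refl
  decode-code Z = refl

_≟ᵇ_ : DecidableEquality BBKMMZ
_≟ᵇ_ = ≡-dec-via-code code decode decode-code where open BBKMMZ-code

∀-Bool? : {P : Bool → Set} → Decidable₁ P → Dec (∀ b → P b)
∀-Bool? P? = map′ (λ (t , f) → λ { true → t ; false → f }) (λ h → h true , h false)
                  (P? true ×-dec P? false)

∀-DNR? : {P : DNR → Set} → Decidable₁ P → Dec (∀ x → P x)
∀-DNR? P? = map′ (λ (d , n , r) → λ { D → d ; N → n ; R → r }) (λ h → h D , h N , h R)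
                 (P? D ×-dec P? N ×-dec P? R)

∃-DNR? : {P : DNR → Set} → Decidable₁ P → Dec (Σ DNR P)
∃-DNR? P? = map′ (λ { (inj₁ d) → D , d ; (inj₂ (inj₁ n)) → N , n ; (inj₂ (inj₂ r)) → R , r })
                 (λ { (D , d) → inj₁ d ; (N , n) → inj₂ (inj₁ n) ; (R , r) → inj₂ (inj₂ r) })
                 (P? D ⊎-dec P? N ⊎-dec P? R)

E-sym : ∀ {n} (H : Graph n) {u w} → E H u w → E H w u
E-sym H {u} {w} e = trans (adj-sym H w u) e

Complete-pullback : {V W : Set} (f : V → W) {R : W → W → Set} {S : V → V → Set} {A B : W → Set} →
                    (∀ u w → R (f u) (f w) → S u w) → Complete R A B → Complete S (A ∘ f) (B ∘ f)
Complete-pullback f R⇒S c u w a b = R⇒S u w (c (f u) (f w) a b)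

AtLeastTwo-⊆ : {V : Set} {A B : V → Set} → A ⊆ B → AtLeastTwo A → AtLeastTwo B
AtLeastTwo-⊆ A⊆B (a , b , a≢b , a∈A , b∈A) = a , b , a≢b , A⊆B a∈A , A⊆B b∈A

AtLeastTwo? : ∀ {n} {A : Fin n → Set} → Decidable₁ A → Dec (AtLeastTwo A)
AtLeastTwo? A? = any? λ a → any? λ b → ¬? (a ≟ᶠ b) ×-dec A? a ×-dec A? b

at-most-one : ∀ {n} {A : Fin n → Set} → ¬ AtLeastTwo A → ∀ a b → A a → A b → a ≡ b
at-most-one few a b a∈A b∈A =
  decidable-stable (a ≟ᶠ b) λ a≢b → few (a , b , a≢b , a∈A , b∈A)

strongSplit-of-small-F : ∀ {n} (H : Graph n) (lab : Fin n → FKZ) →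
  let G = E H ; Fs = Part lab F ; Ks = Part lab K ; Zs = Part lab Z in
  NonAdj G Fs Zs → ReflClique G Ks → Complete G Fs Ks → Independent G Zs →
  (∀ a b → Fs a → Fs b → a ≡ b) → StrongSplit H
strongSplit-of-small-F {n} H lab F-Z K-clique F-K Z-indep unique = inClique , indep , clique
  where
  side : FKZ → Bool → Bool
  side F loop = loop
  side K _ = true
  side Z _ = false

  inClique : Fin n → Bool
  inClique v = side (lab v) (adj H v v)

  loopless : ∀ {a} → adj H a a ≡ false → ¬ E H a a
  loopless p e = contradiction (trans (sym p) e) λ ()

  indep : ∀ a b → side (lab a) (adj H a a) ≡ false → side (lab b) (adj H b b) ≡ false → ¬ E H a b
  indep a b pa pb with lab a in la | lab b in lb
  ... | Z | Z = Z-indep a b la lb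
  ... | F | Z = F-Z a b la lb
  ... | Z | F = λ e → F-Z b a lb la (E-sym H e)
  ... | F | F = subst (λ c → ¬ E H a c) (unique a b la lb) (loopless pa)
  indep a b () pb | K | _
  indep a b pa () | F | K
  indep a b pa () | Z | K

  clique : ∀ a b → side (lab a) (adj H a a) ≡ true → side (lab b) (adj H b b) ≡ true → E H a b
  clique a b pa pb with lab a in la | lab b in lb
  ... | K | K = K-clique a b la lb
  ... | F | K = F-K a b la lb
  ... | K | F = E-sym H (F-K b a lb la)
  ... | F | F = subst (E H a) (unique a b la lb) pa
  clique a b () pb | Z | _
  clique a b pa () | F | Z
  clique a b pa () | K | Z

-- xClass v and yClass v are the classes of v′ and v″; the edge u′w″ of H* is the edge uw of H.
record StarDecomp {n} (H : Graph n) : Set where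
  field
    xClass yClass : Fin n → DNR
    N-nonempty : Nonempty (Part xClass N ∪ Part yClass N)
    D-twice : AtLeastTwo (Part xClass D) ⊎ AtLeastTwo (Part yClass D)
    NN-edges : Complete (E H) (Part xClass N) (Part yClass N)
    DN-edges : Complete (E H) (Part xClass D) (Part yClass N)
    ND-edges : Complete (E H) (Part xClass N) (Part yClass D)
    DR-nonedges : NonAdj (E H) (Part xClass D) (Part yClass R)
    RD-nonedges : NonAdj (E H) (Part xClass R) (Part yClass D)

open StarDecomp

module _ {n} {H : Graph n} where

  starDecomp : BipDecomp H → StarDecomp H
  starDecomp (lab , N≠∅ , D-R , D-two , NN , DN , ND) = record
    { xClass = lab ∘ inj₁
    ; yClass = lab ∘ inj₂
    ; N-nonempty = N-on-H N≠∅
    ; D-twice = ⊎-map onX onY D-two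
    ; NN-edges = λ u w p q → NN (inj₁ u) (inj₂ w) (p , tt) (q , tt)
    ; DN-edges = λ u w p q → DN (inj₁ u) (inj₂ w) (p , tt) (q , tt)
    ; ND-edges = λ u w p q → ND (inj₂ w) (inj₁ u) (q , tt) (p , tt)
    ; DR-nonedges = λ u w p q → D-R (inj₁ u) (inj₂ w) p q
    ; RD-nonedges = λ u w p q → D-R (inj₂ w) (inj₁ u) q p
    }
    where
    N-on-H : Nonempty (Part lab N) → Nonempty (Part (lab ∘ inj₁) N ∪ Part (lab ∘ inj₂) N)
    N-on-H (inj₁ v , p) = v , inj₁ p
    N-on-H (inj₂ v , p) = v , inj₂ p

    onX : AtLeastTwo (Part lab D ∩ IsX) → AtLeastTwo (Part (lab ∘ inj₁) D)
    onX (inj₁ a , inj₁ b , a≢b , (p , _) , (q , _)) = a , b , a≢b ∘ cong inj₁ , p , q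

    onY : AtLeastTwo (Part lab D ∩ IsY) → AtLeastTwo (Part (lab ∘ inj₂) D)
    onY (inj₂ a , inj₂ b , a≢b , (p , _) , (q , _)) = a , b , a≢b ∘ cong inj₂ , p , q

  bipDecomp : StarDecomp H → BipDecomp H
  bipDecomp σ = lab , N≠∅ (N-nonempty σ) , D-R , ⊎-map onX onY (D-twice σ) , NN , DN , ND
    where
    lab : Fin n ⊎ Fin n → DNR
    lab = [ xClass σ , yClass σ ]

    N≠∅ : Nonempty (Part (xClass σ) N ∪ Part (yClass σ) N) → Nonempty (Part lab N)
    N≠∅ (v , inj₁ p) = inj₁ v , p
    N≠∅ (v , inj₂ p) = inj₂ v , p

    onX : AtLeastTwo (Part (xClass σ) D) → AtLeastTwo (Part lab D ∩ IsX)
    onX (a , b , a≢b , p , q) = inj₁ a , inj₁ b , a≢b ∘ inj₁-injective , (p , tt) , (q , tt)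

    onY : AtLeastTwo (Part (yClass σ) D) → AtLeastTwo (Part lab D ∩ IsY)
    onY (a , b , a≢b , p , q) = inj₂ a , inj₂ b , a≢b ∘ inj₂-injective , (p , tt) , (q , tt)

    D-R : NonAdj (Star H) (Part lab D) (Part lab R)
    D-R (inj₁ u) (inj₂ w) p q = DR-nonedges σ u w p q
    D-R (inj₂ u) (inj₁ w) p q = RD-nonedges σ w u q p
    D-R (inj₁ _) (inj₁ _) _ _ ()
    D-R (inj₂ _) (inj₂ _) _ _ ()

    NN : Complete (Star H) (Part lab N ∩ IsX) (Part lab N ∩ IsY)
    NN (inj₁ u) (inj₂ w) (p , _) (q , _) = NN-edges σ u w p q

    DN : Complete (Star H) (Part lab D ∩ IsX) (Part lab N ∩ IsY)
    DN (inj₁ u) (inj₂ w) (p , _) (q , _) = DN-edges σ u w p q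

    ND : Complete (Star H) (Part lab D ∩ IsY) (Part lab N ∩ IsX)
    ND (inj₂ u) (inj₁ w) (p , _) (q , _) = ND-edges σ w u q p

  swap : StarDecomp H → StarDecomp H
  swap σ = record
    { xClass = yClass σ
    ; yClass = xClass σ
    ; N-nonempty = let (v , p) = N-nonempty σ in v , ⊎-swap p
    ; D-twice = ⊎-swap (D-twice σ)
    ; NN-edges = λ u w p q → E-sym H (NN-edges σ w u q p)
    ; DN-edges = λ u w p q → E-sym H (ND-edges σ w u q p)
    ; ND-edges = λ u w p q → E-sym H (DN-edges σ w u q p)
    ; DR-nonedges = λ u w p q → RD-nonedges σ w u q p ∘ E-sym H
    ; RD-nonedges = λ u w p q → DR-nonedges σ w u q p ∘ E-sym H
    }

  with-D-on-X : StarDecomp H → Σ (StarDecomp H) λ σ → AtLeastTwo (Part (xClass σ) D)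
  with-D-on-X σ = [ (λ two → σ , two) , (λ two → swap σ , two) ]′ (D-twice σ)

fClass : FKZ → DNR
fClass F = D
fClass K = N
fClass Z = R

fClass-D : ∀ {a} → fClass a ≡ D → a ≡ F
fClass-D {F} _ = refl

fClass-N : ∀ {a} → fClass a ≡ N → a ≡ K
fClass-N {K} _ = refl

fClass-R : ∀ {a} → fClass a ≡ R → a ≡ Z
fClass-R {Z} _ = refl

fromF : ∀ {n} {H : Graph n} → FDecomp H → StarDecomp H
fromF {H = H} (lab , (k , k∈K) , F-Z , two , K-clique , F-K) = record
  { xClass = fClass ∘ lab
  ; yClass = fClass ∘ lab
  ; N-nonempty = k , inj₁ (cong fClass k∈K)
  ; D-twice = inj₁ (AtLeastTwo-⊆ (cong fClass) two)
  ; NN-edges = λ u w p q → K-clique u w (fClass-N p) (fClass-N q)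
  ; DN-edges = λ u w p q → F-K u w (fClass-D p) (fClass-N q)
  ; ND-edges = λ u w p q → E-sym H (F-K w u (fClass-D q) (fClass-N p))
  ; DR-nonedges = λ u w p q → F-Z u w (fClass-D p) (fClass-R q)
  ; RD-nonedges = λ u w p q → F-Z w u (fClass-D q) (fClass-R p) ∘ E-sym H
  }

bpClassˣ bpClassʸ : BPMKZ → DNR
bpClassˣ B = D
bpClassˣ P = N
bpClassˣ M = N
bpClassˣ K = N
bpClassˣ Z = R
bpClassʸ B = R
bpClassʸ P = D
bpClassʸ M = R
bpClassʸ K = N
bpClassʸ Z = R

bpClassˣ-D : ∀ {a} → bpClassˣ a ≡ D → a ≡ B
bpClassˣ-D {B} _ = refl

bpClassˣ-N : ∀ {a} → bpClassˣ a ≡ N → (a ≡ K ⊎ a ≡ P) ⊎ a ≡ M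
bpClassˣ-N {K} _ = inj₁ (inj₁ refl)
bpClassˣ-N {P} _ = inj₁ (inj₂ refl)
bpClassˣ-N {M} _ = inj₂ refl

bpClassˣ-R : ∀ {a} → bpClassˣ a ≡ R → a ≡ Z
bpClassˣ-R {Z} _ = refl

bpClassʸ-D : ∀ {a} → bpClassʸ a ≡ D → a ≡ P
bpClassʸ-D {P} _ = refl

bpClassʸ-N : ∀ {a} → bpClassʸ a ≡ N → a ≡ K
bpClassʸ-N {K} _ = refl

bpClassʸ-R : ∀ {a} → bpClassʸ a ≡ R → (a ≡ B ⊎ a ≡ M) ⊎ a ≡ Z
bpClassʸ-R {B} _ = inj₁ (inj₁ refl)
bpClassʸ-R {M} _ = inj₁ (inj₂ refl)
bpClassʸ-R {Z} _ = inj₂ refl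

fromBP : ∀ {n} {H : Graph n} → BPDecomp H → StarDecomp H
fromBP {H = H} (lab , KM≠∅ , PB-Z , two , KP-clique , B-indep , M-PK , B-K , B-M) = record
  { xClass = bpClassˣ ∘ lab
  ; yClass = bpClassʸ ∘ lab
  ; N-nonempty = let (k , k∈KM) = KM≠∅ in k , inj₁ ([ cong bpClassˣ , cong bpClassˣ ]′ k∈KM)
  ; D-twice = ⊎-swap (⊎-map (AtLeastTwo-⊆ (cong bpClassʸ)) (AtLeastTwo-⊆ (cong bpClassˣ)) two)
  ; NN-edges = λ u w p q → NN u w (bpClassˣ-N p) (bpClassʸ-N q)
  ; DN-edges = λ u w p q → B-K u w (bpClassˣ-D p) (bpClassʸ-N q)
  ; ND-edges = λ u w p q → ND u w (bpClassˣ-N p) (bpClassʸ-D q)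
  ; DR-nonedges = λ u w p q → DR u w (bpClassˣ-D p) (bpClassʸ-R q)
  ; RD-nonedges = λ u w p q → PB-Z w u (inj₁ (bpClassʸ-D q)) (bpClassˣ-R p) ∘ E-sym H
  }
  where
  NN : ∀ u w → (lab u ≡ K ⊎ lab u ≡ P) ⊎ lab u ≡ M → lab w ≡ K → E H u w
  NN u w (inj₁ u∈KP) w∈K = KP-clique u w u∈KP (inj₁ w∈K)
  NN u w (inj₂ u∈M) w∈K = M-PK u w u∈M (inj₂ w∈K)

  ND : ∀ u w → (lab u ≡ K ⊎ lab u ≡ P) ⊎ lab u ≡ M → lab w ≡ P → E H u w
  ND u w (inj₁ u∈KP) w∈P = KP-clique u w u∈KP (inj₂ w∈P)
  ND u w (inj₂ u∈M) w∈P = M-PK u w u∈M (inj₁ w∈P)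

  DR : ∀ u w → lab u ≡ B → (lab w ≡ B ⊎ lab w ≡ M) ⊎ lab w ≡ Z → ¬ E H u w
  DR u w u∈B (inj₁ (inj₁ w∈B)) = B-indep u w u∈B w∈B
  DR u w u∈B (inj₁ (inj₂ w∈M)) = B-M u w u∈B w∈M
  DR u w u∈B (inj₂ w∈Z) = PB-Z u w (inj₂ u∈B) w∈Z

bClassˣ bClassʸ : BBKMMZ → DNR
bClassˣ B₁ = D
bClassˣ B₂ = R
bClassˣ K = N
bClassˣ M₁ = N
bClassˣ M₂ = R
bClassˣ Z = R
bClassʸ B₁ = R
bClassʸ B₂ = D
bClassʸ K = N
bClassʸ M₁ = R
bClassʸ M₂ = N
bClassʸ Z = R

bClassˣ-D : ∀ {a} → bClassˣ a ≡ D → a ≡ B₁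
bClassˣ-D {B₁} _ = refl

bClassˣ-N : ∀ {a} → bClassˣ a ≡ N → a ≡ K ⊎ a ≡ M₁
bClassˣ-N {K} _ = inj₁ refl
bClassˣ-N {M₁} _ = inj₂ refl

bClassˣ-R : ∀ {a} → bClassˣ a ≡ R → (a ≡ B₂ ⊎ a ≡ M₂) ⊎ a ≡ Z
bClassˣ-R {B₂} _ = inj₁ (inj₁ refl)
bClassˣ-R {M₂} _ = inj₁ (inj₂ refl)
bClassˣ-R {Z} _ = inj₂ refl

bClassʸ-D : ∀ {a} → bClassʸ a ≡ D → a ≡ B₂
bClassʸ-D {B₂} _ = refl

bClassʸ-N : ∀ {a} → bClassʸ a ≡ N → a ≡ K ⊎ a ≡ M₂
bClassʸ-N {K} _ = inj₁ refl
bClassʸ-N {M₂} _ = inj₂ refl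

bClassʸ-R : ∀ {a} → bClassʸ a ≡ R → (a ≡ B₁ ⊎ a ≡ M₁) ⊎ a ≡ Z
bClassʸ-R {B₁} _ = inj₁ (inj₁ refl)
bClassʸ-R {M₁} _ = inj₁ (inj₂ refl)
bClassʸ-R {Z} _ = inj₂ refl

fromB : ∀ {n} {H : Graph n} → BDecomp H → StarDecomp H
fromB {H = H}
  (lab , KM≠∅ , B-Z , two , K-clique , B₁-indep , B₂-indep , K-rest , M₂-M₁B₁ , M₁-B₂ , B₁-M₁ , B₂-M₂) = record
  { xClass = bClassˣ ∘ lab
  ; yClass = bClassʸ ∘ lab
  ; N-nonempty = let (k , k∈KM) = KM≠∅ in k , N-class k∈KM
  ; D-twice = ⊎-map (AtLeastTwo-⊆ (cong bClassˣ)) (AtLeastTwo-⊆ (cong bClassʸ)) two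
  ; NN-edges = λ u w p q → NN u w (bClassˣ-N p) (bClassʸ-N q)
  ; DN-edges = λ u w p q → DN u w (bClassˣ-D p) (bClassʸ-N q)
  ; ND-edges = λ u w p q → ND u w (bClassˣ-N p) (bClassʸ-D q)
  ; DR-nonedges = λ u w p q → DR u w (bClassˣ-D p) (bClassʸ-R q)
  ; RD-nonedges = λ u w p q → RD u w (bClassˣ-R p) (bClassʸ-D q)
  }
  where
  N-class : ∀ {k} → (lab k ≡ K ⊎ lab k ≡ M₁) ⊎ lab k ≡ M₂ →
            bClassˣ (lab k) ≡ N ⊎ bClassʸ (lab k) ≡ N
  N-class (inj₁ (inj₁ k∈K)) = inj₁ (cong bClassˣ k∈K)
  N-class (inj₁ (inj₂ k∈M₁)) = inj₁ (cong bClassˣ k∈M₁)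
  N-class (inj₂ k∈M₂) = inj₂ (cong bClassʸ k∈M₂)

  NN : ∀ u w → lab u ≡ K ⊎ lab u ≡ M₁ → lab w ≡ K ⊎ lab w ≡ M₂ → E H u w
  NN u w (inj₁ u∈K) (inj₁ w∈K) = K-clique u w u∈K w∈K
  NN u w (inj₁ u∈K) (inj₂ w∈M₂) = K-rest u w u∈K (inj₁ (inj₁ (inj₂ w∈M₂)))
  NN u w (inj₂ u∈M₁) (inj₁ w∈K) = E-sym H (K-rest w u w∈K (inj₁ (inj₁ (inj₁ u∈M₁))))
  NN u w (inj₂ u∈M₁) (inj₂ w∈M₂) = E-sym H (M₂-M₁B₁ w u w∈M₂ (inj₁ u∈M₁))

  DN : ∀ u w → lab u ≡ B₁ → lab w ≡ K ⊎ lab w ≡ M₂ → E H u w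
  DN u w u∈B₁ (inj₁ w∈K) = E-sym H (K-rest w u w∈K (inj₁ (inj₂ u∈B₁)))
  DN u w u∈B₁ (inj₂ w∈M₂) = E-sym H (M₂-M₁B₁ w u w∈M₂ (inj₂ u∈B₁))

  ND : ∀ u w → lab u ≡ K ⊎ lab u ≡ M₁ → lab w ≡ B₂ → E H u w
  ND u w (inj₁ u∈K) w∈B₂ = K-rest u w u∈K (inj₂ w∈B₂)
  ND u w (inj₂ u∈M₁) w∈B₂ = M₁-B₂ u w u∈M₁ w∈B₂

  DR : ∀ u w → lab u ≡ B₁ → (lab w ≡ B₁ ⊎ lab w ≡ M₁) ⊎ lab w ≡ Z → ¬ E H u w
  DR u w u∈B₁ (inj₁ (inj₁ w∈B₁)) = B₁-indep u w u∈B₁ w∈B₁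
  DR u w u∈B₁ (inj₁ (inj₂ w∈M₁)) = B₁-M₁ u w u∈B₁ w∈M₁
  DR u w u∈B₁ (inj₂ w∈Z) = B-Z u w (inj₁ u∈B₁) w∈Z

  RD : ∀ u w → (lab u ≡ B₂ ⊎ lab u ≡ M₂) ⊎ lab u ≡ Z → lab w ≡ B₂ → ¬ E H u w
  RD u w (inj₁ (inj₁ u∈B₂)) w∈B₂ = B₂-indep u w u∈B₂ w∈B₂
  RD u w (inj₁ (inj₂ u∈M₂)) w∈B₂ = B₂-M₂ w u w∈B₂ u∈M₂ ∘ E-sym H
  RD u w (inj₂ u∈Z) w∈B₂ = B-Z w u (inj₂ w∈B₂) u∈Z ∘ E-sym H

Ty : Set
Ty = DNR × DNR

-- joins x y (separates x y): every vertex of X in class x is adjacent (non-adjacent)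
-- in H* to every vertex of Y in class y.
joins separates : DNR → DNR → Bool
joins N N = true
joins D N = true
joins N D = true
joins _ _ = false
separates D R = true
separates R D = true
separates _ _ = false

forced forbidden : Ty → Ty → Bool
forced (x , y) (x′ , y′) = joins x y′ ∨ joins x′ y
forbidden (x , y) (x′ , y′) = separates x y′ ∨ separates x′ y

record Profile : Set where
  constructor profile
  field dd dn dr nd nn nr rd rn rr : Bool

_∋_ : Profile → Ty → Bool
p ∋ (D , D) = Profile.dd p
p ∋ (D , N) = Profile.dn p
p ∋ (D , R) = Profile.dr p
p ∋ (N , D) = Profile.nd p
p ∋ (N , N) = Profile.nn p
p ∋ (N , R) = Profile.nr p
p ∋ (R , D) = Profile.rd p
p ∋ (R , N) = Profile.rn p
p ∋ (R , R) = Profile.rr p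

tabulate : (Ty → Bool) → Profile
tabulate f = profile (f (D , D)) (f (D , N)) (f (D , R)) (f (N , D)) (f (N , N))
                     (f (N , R)) (f (R , D)) (f (R , N)) (f (R , R))

∋-tabulate : ∀ f t → tabulate f ∋ t ≡ f t
∋-tabulate f (D , D) = refl
∋-tabulate f (D , N) = refl
∋-tabulate f (D , R) = refl
∋-tabulate f (N , D) = refl
∋-tabulate f (N , N) = refl
∋-tabulate f (N , R) = refl
∋-tabulate f (R , D) = refl
∋-tabulate f (R , N) = refl
∋-tabulate f (R , R) = refl

Occurs : Profile → Ty → Set
Occurs p t = T (p ∋ t)

D-types : Profile → Ty → Set
D-types p = Occurs p ∩ Part proj₁ D

Forced Forbidden : Profile → Ty → Ty → Set
Forced p t s = Occurs p t → Occurs p s → T (forced t s)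
Forbidden p t s = Occurs p t → Occurs p s → T (forbidden t s)

Isolated : Profile → Ty → Set
Isolated p t = Occurs p t × Nonempty (Occurs p ∩ (_≢ t)) × Complete (Forbidden p) (_≡ t) (_≢ t)

Admissible : Profile → Set
Admissible p =
  Nonempty (D-types p) ×
  Nonempty (Occurs p ∩ (Part proj₁ N ∪ Part proj₂ N)) ×
  Complete (λ t s → ¬ (T (forced t s) × T (forbidden t s))) (Occurs p) (Occurs p) ×
  (∀ t → ¬ Isolated p t)

-- Conditions on a labelling g of the types making g ∘ type a B-, BP- or F-decomposition
-- of H.  A part of size ≥ 2 is obtained by containing all D-types (two vertices are in
-- class D on the X side), or for F also by Z being independent.

ProfileBDecomp : Profile → (Ty → BBKMMZ) → Set
ProfileBDecomp p g =
  let B1 = Part g B₁ ; B2 = Part g B₂ ; Ks = Part g K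
      M1 = Part g M₁ ; M2 = Part g M₂ ; Zs = Part g Z in
  Nonempty (Occurs p ∩ ((Ks ∪ M1) ∪ M2)) ×
  Complete (Forbidden p) (B1 ∪ B2) Zs ×
  D-types p ⊆ B1 ×
  ReflClique (Forced p) Ks ×
  Complete (Forbidden p) B1 B1 ×
  Complete (Forbidden p) B2 B2 ×
  Complete (Forced p) Ks (((M1 ∪ M2) ∪ B1) ∪ B2) ×
  Complete (Forced p) M2 (M1 ∪ B1) ×
  Complete (Forced p) M1 B2 ×
  Complete (Forbidden p) B1 M1 ×
  Complete (Forbidden p) B2 M2

ProfileBPDecomp : Profile → (Ty → BPMKZ) → Set
ProfileBPDecomp p g =
  let Bs = Part g B ; Ps = Part g P ; Ms = Part g M ; Ks = Part g K ; Zs = Part g Z in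
  Nonempty (Occurs p ∩ (Ks ∪ Ms)) ×
  Complete (Forbidden p) (Ps ∪ Bs) Zs ×
  (D-types p ⊆ Ps ⊎ D-types p ⊆ Bs) ×
  ReflClique (Forced p) (Ks ∪ Ps) ×
  Complete (Forbidden p) Bs Bs ×
  Complete (Forced p) Ms (Ps ∪ Ks) ×
  Complete (Forced p) Bs Ks ×
  Complete (Forbidden p) Bs Ms

ProfileFDecomp : Profile → (Ty → FKZ) → Set
ProfileFDecomp p g =
  let Fs = Part g F ; Ks = Part g K ; Zs = Part g Z in
  Nonempty (Occurs p ∩ Ks) ×
  Complete (Forbidden p) Fs Zs ×
  ReflClique (Forced p) Ks ×
  Complete (Forced p) Fs Ks ×
  (D-types p ⊆ Fs ⊎ Complete (Forbidden p) Zs Zs)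

bLabelling : Ty → BBKMMZ
bLabelling (D , R) = B₁
bLabelling (R , D) = B₂
bLabelling (N , N) = K
bLabelling (N , R) = M₁
bLabelling (R , N) = M₂
bLabelling _ = Z

bpLabelling : Ty → BPMKZ
bpLabelling (D , R) = B
bpLabelling (R , D) = B
bpLabelling (D , N) = P
bpLabelling (N , D) = P
bpLabelling (N , R) = M
bpLabelling (R , N) = M
bpLabelling (N , N) = K
bpLabelling _ = Z

fLabelling-D : Ty → FKZ
fLabelling-D (N , N) = K
fLabelling-D (D , _) = F
fLabelling-D (_ , D) = F
fLabelling-D _ = Z

fLabelling-DD : Ty → FKZ
fLabelling-DD (D , D) = F
fLabelling-DD (R , _) = Z
fLabelling-DD (_ , R) = Z
fLabelling-DD _ = K

Decomposable : Profile → Set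
Decomposable p =
  ProfileBDecomp p bLabelling ⊎ ProfileBPDecomp p bpLabelling ⊎
  ProfileFDecomp p fLabelling-D ⊎ ProfileFDecomp p fLabelling-DD

_≟ᵗ_ : DecidableEquality Ty
_≟ᵗ_ = ≡-dec _≟ᴰ_ _≟ᴰ_

∀-Ty? : {P : Ty → Set} → Decidable₁ P → Dec (∀ t → P t)
∀-Ty? P? = map′ (λ h (x , y) → h x y) (λ h x y → h (x , y))
                (∀-DNR? λ x → ∀-DNR? λ y → P? (x , y))

∃-Ty? : {P : Ty → Set} → Decidable₁ P → Dec (Σ Ty P)
∃-Ty? P? = map′ (λ (x , y , p) → (x , y) , p) (λ ((x , y) , p) → x , y , p)
                (∃-DNR? λ x → ∃-DNR? λ y → P? (x , y))

∀-Profile? : {P : Profile → Set} → Decidable₁ P → Dec (∀ p → P p)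
∀-Profile? P? = map′ (λ h p → h _ _ _ _ _ _ _ _ _) (λ h _ _ _ _ _ _ _ _ _ → h _)
  (∀-Bool? λ b₁ → ∀-Bool? λ b₂ → ∀-Bool? λ b₃ → ∀-Bool? λ b₄ → ∀-Bool? λ b₅ →
   ∀-Bool? λ b₆ → ∀-Bool? λ b₇ → ∀-Bool? λ b₈ → ∀-Bool? λ b₉ →
   P? (profile b₁ b₂ b₃ b₄ b₅ b₆ b₇ b₈ b₉))

-- A is tested before quantifying over s, which halves the cost of the exhaustive check.
Complete? : {R : Ty → Ty → Set} {A B : Ty → Set} →
            (∀ t s → Dec (R t s)) → Decidable₁ A → Decidable₁ B → Dec (Complete R A B)
Complete? R? A? B? = map′ (λ h t s a b → h t a s b) (λ h t a s b → h t s a b)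
                          (∀-Ty? λ t → A? t →-dec ∀-Ty? λ s → B? s →-dec R? t s)

_⊆?_ : {A B : Ty → Set} → Decidable₁ A → Decidable₁ B → Dec (A ⊆ B)
A? ⊆? B? = map′ (λ h {t} → h t) (λ h t → h) (∀-Ty? λ t → A? t →-dec B? t)

Part? : {L : Set} → DecidableEquality L → (g : Ty → L) (ℓ : L) → Decidable₁ (Part g ℓ)
Part? _≟_ g ℓ t = g t ≟ ℓ

Occurs? : ∀ p → Decidable₁ (Occurs p)
Occurs? p t = T? (p ∋ t)

D-types? : ∀ p → Decidable₁ (D-types p)
D-types? p = Occurs? p ∩? Part? _≟ᴰ_ proj₁ D

Forced? : ∀ p t s → Dec (Forced p t s)
Forced? p t s = Occurs? p t →-dec (Occurs? p s →-dec T? (forced t s))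

Forbidden? : ∀ p t s → Dec (Forbidden p t s)
Forbidden? p t s = Occurs? p t →-dec (Occurs? p s →-dec T? (forbidden t s))

Isolated? : ∀ p t → Dec (Isolated p t)
Isolated? p t =
  Occurs? p t ×-dec
  ∃-Ty? (Occurs? p ∩? λ s → ¬? (s ≟ᵗ t)) ×-dec
  Complete? (Forbidden? p) (_≟ᵗ t) (λ s → ¬? (s ≟ᵗ t))

Admissible? : ∀ p → Dec (Admissible p)
Admissible? p =
  ∃-Ty? (D-types? p) ×-dec
  ∃-Ty? (Occurs? p ∩? (Part? _≟ᴰ_ proj₁ N ∪? Part? _≟ᴰ_ proj₂ N)) ×-dec
  Complete? (λ t s → ¬? (T? (forced t s) ×-dec T? (forbidden t s))) (Occurs? p) (Occurs? p) ×-dec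
  ∀-Ty? (¬? ∘ Isolated? p)

ProfileBDecomp? : ∀ p g → Dec (ProfileBDecomp p g)
ProfileBDecomp? p g =
  let B1 = Part? _≟ᵇ_ g B₁ ; B2 = Part? _≟ᵇ_ g B₂ ; Ks = Part? _≟ᵇ_ g K
      M1 = Part? _≟ᵇ_ g M₁ ; M2 = Part? _≟ᵇ_ g M₂ ; Zs = Part? _≟ᵇ_ g Z in
  ∃-Ty? (Occurs? p ∩? ((Ks ∪? M1) ∪? M2)) ×-dec
  Complete? (Forbidden? p) (B1 ∪? B2) Zs ×-dec
  D-types? p ⊆? B1 ×-dec
  Complete? (Forced? p) Ks Ks ×-dec
  Complete? (Forbidden? p) B1 B1 ×-dec
  Complete? (Forbidden? p) B2 B2 ×-dec
  Complete? (Forced? p) Ks (((M1 ∪? M2) ∪? B1) ∪? B2) ×-dec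
  Complete? (Forced? p) M2 (M1 ∪? B1) ×-dec
  Complete? (Forced? p) M1 B2 ×-dec
  Complete? (Forbidden? p) B1 M1 ×-dec
  Complete? (Forbidden? p) B2 M2

ProfileBPDecomp? : ∀ p g → Dec (ProfileBPDecomp p g)
ProfileBPDecomp? p g =
  let Bs = Part? _≟ᵇᵖ_ g B ; Ps = Part? _≟ᵇᵖ_ g P ; Ms = Part? _≟ᵇᵖ_ g M
      Ks = Part? _≟ᵇᵖ_ g K ; Zs = Part? _≟ᵇᵖ_ g Z in
  ∃-Ty? (Occurs? p ∩? (Ks ∪? Ms)) ×-dec
  Complete? (Forbidden? p) (Ps ∪? Bs) Zs ×-dec
  (D-types? p ⊆? Ps ⊎-dec D-types? p ⊆? Bs) ×-dec
  Complete? (Forced? p) (Ks ∪? Ps) (Ks ∪? Ps) ×-dec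
  Complete? (Forbidden? p) Bs Bs ×-dec
  Complete? (Forced? p) Ms (Ps ∪? Ks) ×-dec
  Complete? (Forced? p) Bs Ks ×-dec
  Complete? (Forbidden? p) Bs Ms

ProfileFDecomp? : ∀ p g → Dec (ProfileFDecomp p g)
ProfileFDecomp? p g =
  let Fs = Part? _≟ᶠᵏᶻ_ g F ; Ks = Part? _≟ᶠᵏᶻ_ g K ; Zs = Part? _≟ᶠᵏᶻ_ g Z in
  ∃-Ty? (Occurs? p ∩? Ks) ×-dec
  Complete? (Forbidden? p) Fs Zs ×-dec
  Complete? (Forced? p) Ks Ks ×-dec
  Complete? (Forced? p) Fs Ks ×-dec
  (D-types? p ⊆? Fs ⊎-dec Complete? (Forbidden? p) Zs Zs)

Decomposable? : ∀ p → Dec (Decomposable p)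
Decomposable? p =
  ProfileBDecomp? p bLabelling ⊎-dec ProfileBPDecomp? p bpLabelling ⊎-dec
  ProfileFDecomp? p fLabelling-D ⊎-dec ProfileFDecomp? p fLabelling-DD

admissible⇒decomposable : ∀ p → Admissible p → Decomposable p
admissible⇒decomposable = toWitness {a? = ∀-Profile? λ p → Admissible? p →-dec Decomposable? p} tt

module FromTypes {n} {H : Graph n} (σ : StarDecomp H) (D-twice-on-X : AtLeastTwo (Part (xClass σ) D))
  where

  type : Fin n → Ty
  type v = xClass σ v , yClass σ v

  occurs : Ty → Bool
  occurs t = isYes (any? λ v → type v ≟ᵗ t)

  typeProfile : Profile
  typeProfile = tabulate occurs

  type-occurs : ∀ v → Occurs typeProfile (type v)
  type-occurs v = subst T (sym (∋-tabulate occurs (type v))) (fromWitness (v , refl))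

  occurring : ∀ t → Occurs typeProfile t → ∃ λ v → type v ≡ t
  occurring t o = toWitness (subst T (∋-tabulate occurs t) o)

  joins-edge : ∀ {u w} x y → xClass σ u ≡ x → yClass σ w ≡ y → T (joins x y) → E H u w
  joins-edge N N p q _ = NN-edges σ _ _ p q
  joins-edge D N p q _ = DN-edges σ _ _ p q
  joins-edge N D p q _ = ND-edges σ _ _ p q

  separates-nonedge : ∀ {u w} x y → xClass σ u ≡ x → yClass σ w ≡ y → T (separates x y) →
                      ¬ E H u w
  separates-nonedge D R p q _ = DR-nonedges σ _ _ p q
  separates-nonedge R D p q _ = RD-nonedges σ _ _ p q

  forced-edge : ∀ u w → T (forced (type u) (type w)) → E H u w
  forced-edge u w f with Equivalence.to T-∨ f
  ... | inj₁ j = joins-edge _ _ refl refl j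
  ... | inj₂ j = E-sym H (joins-edge _ _ refl refl j)

  forbidden-nonedge : ∀ u w → T (forbidden (type u) (type w)) → ¬ E H u w
  forbidden-nonedge u w f with Equivalence.to T-∨ f
  ... | inj₁ s = separates-nonedge _ _ refl refl s
  ... | inj₂ s = separates-nonedge _ _ refl refl s ∘ E-sym H

  edges : {A B : Ty → Set} → Complete (Forced typeProfile) A B →
          Complete (E H) (A ∘ type) (B ∘ type)
  edges = Complete-pullback type λ u w f → forced-edge u w (f (type-occurs u) (type-occurs w))

  nonedges : {A B : Ty → Set} → Complete (Forbidden typeProfile) A B →
             NonAdj (E H) (A ∘ type) (B ∘ type)
  nonedges = Complete-pullback type λ u w f → forbidden-nonedge u w (f (type-occurs u) (type-occurs w))

  nonempty : {A : Ty → Set} → Nonempty (Occurs typeProfile ∩ A) → Nonempty (A ∘ type)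
  nonempty (t , o , a) with occurring t o
  ... | v , refl = v , a

  atLeastTwo-⊇D : {A : Ty → Set} → D-types typeProfile ⊆ A → AtLeastTwo (A ∘ type)
  atLeastTwo-⊇D D⊆A = AtLeastTwo-⊆ (λ {v} v∈D → D⊆A (type-occurs v , v∈D)) D-twice-on-X

  reach-stays-in-type : ∀ t → Complete (Forbidden typeProfile) (_≡ t) (_≢ t) →
          ∀ {u w} → Reach (E H) u w → type u ≡ t → type w ≡ t
  reach-stays-in-type t sep here u∈t = u∈t
  reach-stays-in-type t sep {u} (step {w = z} e r) u∈t with type z ≟ᵗ t
  ... | yes z∈t = reach-stays-in-type t sep r z∈t
  ... | no z∉t = ⊥-elim (forbidden-nonedge u z (sep _ _ u∈t z∉t (type-occurs u) (type-occurs z)) e)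

  admissible : Connected (E H) → Admissible typeProfile
  admissible connected = D-occurs D-twice-on-X , N-occurs (N-nonempty σ) , no-clash , no-isolated
    where
    D-occurs : AtLeastTwo (Part (xClass σ) D) → Nonempty (D-types typeProfile)
    D-occurs (a , _ , _ , a∈D , _) = type a , type-occurs a , a∈D

    N-occurs : Nonempty (Part (xClass σ) N ∪ Part (yClass σ) N) →
               Nonempty (Occurs typeProfile ∩ (Part proj₁ N ∪ Part proj₂ N))
    N-occurs (v , p) = type v , type-occurs v , p

    no-clash : ∀ t s → Occurs typeProfile t → Occurs typeProfile s →
               ¬ (T (forced t s) × T (forbidden t s))
    no-clash t s o o′ (f , b) with occurring t o | occurring s o′
    ... | u , refl | w , refl = forbidden-nonedge u w b (forced-edge u w f)

    no-isolated : ∀ t → ¬ Isolated typeProfile t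
    no-isolated t (o , (s , o′ , s≢t) , sep) with occurring t o | occurring s o′
    ... | u , refl | w , refl = s≢t (reach-stays-in-type t sep (connected u w) refl)

  bDecomp : (g : Ty → BBKMMZ) → ProfileBDecomp typeProfile g → BDecomp H
  bDecomp g
    (KM≠∅ , B-Z , D⊆B₁ , K-clique , B₁-indep , B₂-indep , K-rest , M₂-M₁B₁ , M₁-B₂ , B₁-M₁ , B₂-M₂) =
    g ∘ type , nonempty KM≠∅ , nonedges B-Z , inj₁ (atLeastTwo-⊇D D⊆B₁) , edges K-clique ,
    nonedges B₁-indep , nonedges B₂-indep , edges K-rest , edges M₂-M₁B₁ , edges M₁-B₂ ,
    nonedges B₁-M₁ , nonedges B₂-M₂

  bpDecomp : (g : Ty → BPMKZ) → ProfileBPDecomp typeProfile g → BPDecomp H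
  bpDecomp g (KM≠∅ , PB-Z , D⊆P-or-B , KP-clique , B-indep , M-PK , B-K , B-M) =
    g ∘ type , nonempty KM≠∅ , nonedges PB-Z , P-or-B-twice D⊆P-or-B , edges KP-clique ,
    nonedges B-indep , edges M-PK , edges B-K , nonedges B-M
    where
    P-or-B-twice : D-types typeProfile ⊆ Part g P ⊎ D-types typeProfile ⊆ Part g B →
                   AtLeastTwo (Part (g ∘ type) P) ⊎ AtLeastTwo (Part (g ∘ type) B)
    P-or-B-twice (inj₁ D⊆P) = inj₁ (atLeastTwo-⊇D D⊆P)
    P-or-B-twice (inj₂ D⊆B) = inj₂ (atLeastTwo-⊇D D⊆B)

  fDecomp-or-split : (g : Ty → FKZ) → ProfileFDecomp typeProfile g → FDecomp H ⊎ StrongSplit H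
  fDecomp-or-split g (K≠∅ , F-Z , K-clique , F-K , D⊆F-or-Z-indep) =
    by-size (AtLeastTwo? λ v → g (type v) ≟ᶠᵏᶻ F) D⊆F-or-Z-indep
    where
    by-size : Dec (AtLeastTwo (Part (g ∘ type) F)) →
              D-types typeProfile ⊆ Part g F ⊎ Complete (Forbidden typeProfile) (Part g Z) (Part g Z) →
              FDecomp H ⊎ StrongSplit H
    by-size (yes F-two) _ =
      inj₁ (g ∘ type , nonempty K≠∅ , nonedges F-Z , F-two , edges K-clique , edges F-K)
    by-size (no F-few) (inj₁ D⊆F) = ⊥-elim (F-few (atLeastTwo-⊇D D⊆F))
    by-size (no F-few) (inj₂ Z-indep) = inj₂ (strongSplit-of-small-F H (g ∘ type)
      (nonedges F-Z) (edges K-clique) (edges F-K) (nonedges Z-indep) (at-most-one F-few))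

  decompose : Connected (E H) → ¬ StrongSplit H → BDecomp H ⊎ BPDecomp H ⊎ FDecomp H
  decompose connected notSplit = from (admissible⇒decomposable typeProfile (admissible connected))
    where
    fDecomp : (g : Ty → FKZ) → ProfileFDecomp typeProfile g → FDecomp H
    fDecomp g f = [ id , ⊥-elim ∘ notSplit ]′ (fDecomp-or-split g f)

    from : Decomposable typeProfile → BDecomp H ⊎ BPDecomp H ⊎ FDecomp H
    from (inj₁ b) = inj₁ (bDecomp bLabelling b)
    from (inj₂ (inj₁ bp)) = inj₂ (inj₁ (bpDecomp bpLabelling bp))
    from (inj₂ (inj₂ (inj₁ f))) = inj₂ (inj₂ (fDecomp fLabelling-D f))
    from (inj₂ (inj₂ (inj₂ f))) = inj₂ (inj₂ (fDecomp fLabelling-DD f))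

mainTheorem11 : ∀ {n : ℕ} (H : Graph n) → Connected (E H) → ¬ BiArc H → ¬ StrongSplit H →
    (BipDecomp H ⇔ (BDecomp H ⊎ BPDecomp H ⊎ FDecomp H))
mainTheorem11 H connected _ notSplit = mk⇔ decompose (bipDecomp ∘ [ fromB , [ fromBP , fromF ]′ ]′)
  where
  decompose : BipDecomp H → BDecomp H ⊎ BPDecomp H ⊎ FDecomp H
  decompose d = let (σ , two) = with-D-on-X (starDecomp d) in FromTypes.decompose σ two connected notSplit
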